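{- For any finite simple graph $G$, $\dim_{\mathrm{poc}}(G)\le |V(G)|$.
   Context: For $\mathbf{x},\mathbf{y}\in\mathbb{R}^d$, $\mathbf{x}\prec\mathbf{y}$ means $x_i<y_i$ for all $i$. For finite $S\subseteq\mathbb{R}^d$, $D_S$ is the digraph on $S$ with an arc $(\mathbf{x},\mathbf{v})$ whenever $\mathbf{v}\prec\mathbf{x}$; by convention $\mathbb{R}^0$ is a single point. The competition graph $C(D)$ of a digraph $D$ has vertex set $V(D)$ and an edge between distinct $x,y$ iff some $z$ has arcs $(x,z),(y,z)$. The partial order competition dimension $\dim_{\mathrm{poc}}(G)$ is the smallest nonnegative integer $d$ such that for some nonnegative integer $k$ and some finite $S\subseteq\mathbb{R}^d$, the disjoint union of $G$ and $k$ isolated vertices is isomorphic to $C(D_S)$. -}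

module Defs where

open import Data.Nat using (ℕ; _≤_)
open import Data.Fin using (Fin)
open import Data.Sum using (_⊎_; inj₁; inj₂)
open import Data.Product using (Σ; ∃; ∃-syntax; _×_)
open import Data.Empty using (⊥)
open import Data.Vec using (Vec)
open import Data.Vec.Relation.Binary.Pointwise.Inductive using (Pointwise)
open import Data.Rational using (ℚ) renaming (_<_ to _<ℚ_)
open import Relation.Nullary using (¬_; Dec)
open import Relation.Binary.PropositionalEquality using (_≡_)
open import Function.Bundles using (_⇔_)
open import Function.Definitions using (Injective)

record SimpleGraph (n : ℕ) : Set₁ where
  field
    Adj    : Fin n → Fin n → Set
    sym    : ∀ {i j} → Adj i j → Adj j i
    irrefl : ∀ {i} → ¬ Adj i i
    dec    : ∀ i j → Dec (Adj i j)
open SimpleGraph public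

Point : ℕ → Set
Point d = Vec ℚ d

_≺_ : ∀ {d} → Point d → Point d → Set
x ≺ y = Pointwise _<ℚ_ x y

PlusIso : ℕ → ℕ → Set
PlusIso n k = Fin n ⊎ Fin k

AdjPlus : ∀ {n} → SimpleGraph n → (k : ℕ) → PlusIso n k → PlusIso n k → Set
AdjPlus G k (inj₁ i) (inj₁ j) = Adj G i j
AdjPlus G k _        _        = ⊥

-- Competition graph of D_S, where S is the image of an injective point map p:
-- distinct x, y are adjacent iff some z ∈ S has z ≺ x and z ≺ y
-- (arcs (x,z),(y,z) of D_S).
CompAdj : ∀ {V : Set} {d} → (V → Point d) → V → V → Set
CompAdj {V} p u v = ∃[ w ] (p w ≺ p u × p w ≺ p v)

-- G ⊕ k isolated vertices ≅ C(D_S) for some finite S ⊆ ℚ^d,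
-- the isomorphism being u ↦ p u (p injective, S = image of p).
Representable : ∀ {n} → SimpleGraph n → ℕ → Set
Representable {n} G d =
  ∃[ k ] Σ (PlusIso n k → Point d) λ p →
    Injective _≡_ _≡_ p ×
    (∀ u v → ¬ u ≡ v → (AdjPlus G k u v ⇔ CompAdj p u v))

DimPocLe : ∀ {n} → SimpleGraph n → ℕ → Set
DimPocLe G m = ∃[ d ] (d ≤ m × Representable G d)

-- Place vertex m at the point x_m with coordinate 2 at m and 3 elsewhere; these
-- points are pairwise incomparable. For every ordered pair (i , j) add a witness
-- point z_ij with coordinate 0 at i (so nothing lies below it), 2 off {i , j},
-- and at j ≠ i the value 1 if ij is an edge and 3 otherwise (never 2, so z_ij
-- determines j and the witnesses are distinct). Then z_ij ≺ x_u forces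
-- z_ij[u] < 2, i.e. u = i, or u = j with ij an edge; and for an edge ij the
-- witness z_ij lies below both x_i and x_j. So exactly the adjacent vertices
-- compete, and the n² witnesses are the isolated vertices.
module Submission where

open import Defs hiding (sym)
open import Data.Nat using (ℕ; _*_; _<_; _≤_; z≤n; s≤s)
open import Data.Nat.Properties using (≤-refl; n≮0; ≤⇒≯)
open import Data.Integer using (+_)
import Data.Integer as ℤ
import Data.Integer.Properties as ℤ
open import Data.Rational using (ℚ; ↥_) renaming (_<_ to _<ℚ_)
open import Data.Rational.Literals using (fromℤ)
import Data.Rational as ℚ
open import Data.Fin using (Fin; _≟_; remQuot; combine)
open import Data.Fin.Properties using (remQuot-combine; combine-remQuot)
open import Data.Vec using (tabulate; lookup)
open import Data.Vec.Properties using (lookup∘tabulate)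
open import Data.Vec.Relation.Binary.Pointwise.Inductive using (tabulate⁺; tabulate⁻)
open import Data.Sum using (_⊎_; inj₁; inj₂)
open import Data.Product using (_×_; _,_; uncurry)
open import Function using (_∘_)
open import Function.Bundles using (_⇔_; mk⇔)
open import Function.Definitions using (Injective)
open import Relation.Nullary using (¬_; yes; no; contradiction)
open import Relation.Binary.PropositionalEquality
  using (_≡_; _≢_; refl; sym; trans; cong; subst; subst₂; module ≡-Reasoning)

ι : ℕ → ℚ
ι m = fromℤ (+ m)

ι-injective : ∀ {m n} → ι m ≡ ι n → m ≡ n
ι-injective = cong (ℤ.∣_∣ ∘ ↥_)

ι-mono-< : ∀ {m n} → m < n → ι m <ℚ ι n
ι-mono-< {m} {n} m<n =
  ℚ.*<* (subst₂ ℤ._<_ (sym (ℤ.*-identityʳ (+ m))) (sym (ℤ.*-identityʳ (+ n))) (ℤ.+<+ m<n))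

ι-cancel-< : ∀ {m n} → ι m <ℚ ι n → m < n
ι-cancel-< {m} {n} (ℚ.*<* m<n)
  with ℤ.+<+ m<n′ ← subst₂ ℤ._<_ (ℤ.*-identityʳ (+ m)) (ℤ.*-identityʳ (+ n)) m<n = m<n′

point : ∀ {d} → (Fin d → ℕ) → Point d
point f = tabulate (ι ∘ f)

point-injective : ∀ {d} {f g : Fin d → ℕ} → point f ≡ point g → ∀ l → f l ≡ g l
point-injective {f = f} {g} eq l = ι-injective (begin
  ι (f l)               ≡⟨ lookup∘tabulate (ι ∘ f) l ⟨
  lookup (point f) l    ≡⟨ cong (λ x → lookup x l) eq ⟩
  lookup (point g) l    ≡⟨ lookup∘tabulate (ι ∘ g) l ⟩
  ι (g l)               ∎)
  where open ≡-Reasoning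

point-≺⁺ : ∀ {d} {f g : Fin d → ℕ} → (∀ l → f l < g l) → point f ≺ point g
point-≺⁺ f<g = tabulate⁺ (ι-mono-< ∘ f<g)

point-≺⁻ : ∀ {d} {f g : Fin d → ℕ} → point f ≺ point g → ∀ l → f l < g l
point-≺⁻ f≺g = ι-cancel-< ∘ tabulate⁻ f≺g

point-≺-zero : ∀ {d} {f g : Fin d → ℕ} l → g l ≡ 0 → ¬ point f ≺ point g
point-≺-zero {f = f} l gl≡0 f≺g = n≮0 (subst (f l <_) gl≡0 (point-≺⁻ f≺g l))

remQuot-injective : ∀ {m} n {c c′ : Fin (m * n)} → remQuot {m} n c ≡ remQuot n c′ → c ≡ c′
remQuot-injective {m} n {c} {c′} eq =
  trans (sym (combine-remQuot {m} n c)) (trans (cong (uncurry combine) eq) (combine-remQuot {m} n c′))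

module Construction {n : ℕ} (G : SimpleGraph n) where

  vertexCoord : Fin n → Fin n → ℕ
  vertexCoord m l with l ≟ m
  ... | yes _ = 2
  ... | no  _ = 3

  witnessCoord : Fin n → Fin n → Fin n → ℕ
  witnessCoord i j l with l ≟ i | l ≟ j | dec G i j
  ... | yes _ | _     | _     = 0
  ... | no  _ | yes _ | yes _ = 1
  ... | no  _ | yes _ | no  _ = 3
  ... | no  _ | no  _ | _     = 2

  vertexCoord-self : ∀ m → vertexCoord m m ≡ 2
  vertexCoord-self m with m ≟ m
  ... | yes _ = refl
  ... | no m≢m = contradiction refl m≢m

  vertexCoord-other : ∀ m l → l ≢ m → vertexCoord m l ≡ 3
  vertexCoord-other m l l≢m with l ≟ m
  ... | yes l≡m = contradiction l≡m l≢m
  ... | no  _   = refl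

  2≤vertexCoord : ∀ m l → 2 ≤ vertexCoord m l
  2≤vertexCoord m l with l ≟ m
  ... | yes _ = ≤-refl
  ... | no  _ = s≤s (s≤s z≤n)

  vertexCoord≢0 : ∀ m l → vertexCoord m l ≢ 0
  vertexCoord≢0 m l with l ≟ m
  ... | yes _ = λ ()
  ... | no  _ = λ ()

  witnessCoord-fst : ∀ i j → witnessCoord i j i ≡ 0
  witnessCoord-fst i j with i ≟ i
  ... | yes _ = refl
  ... | no i≢i = contradiction refl i≢i

  witnessCoord≡0⇒fst : ∀ i j l → witnessCoord i j l ≡ 0 → l ≡ i
  witnessCoord≡0⇒fst i j l with l ≟ i | l ≟ j | dec G i j
  ... | yes l≡i | _     | _     = λ _ → l≡i
  ... | no  _   | yes _ | yes _ = λ ()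
  ... | no  _   | yes _ | no  _ = λ ()
  ... | no  _   | no  _ | _     = λ ()

  witnessCoord-off : ∀ i j l → l ≢ i → l ≢ j → witnessCoord i j l ≡ 2
  witnessCoord-off i j l l≢i l≢j with l ≟ i | l ≟ j
  ... | yes l≡i | _       = contradiction l≡i l≢i
  ... | no  _   | yes l≡j = contradiction l≡j l≢j
  ... | no  _   | no  _   = refl

  witnessCoord-snd≢2 : ∀ i j → j ≢ i → witnessCoord i j j ≢ 2
  witnessCoord-snd≢2 i j j≢i with j ≟ i | j ≟ j | dec G i j
  ... | yes j≡i | _      | _     = contradiction j≡i j≢i
  ... | no  _   | yes _  | yes _ = λ ()
  ... | no  _   | yes _  | no  _ = λ ()
  ... | no  _   | no j≢j | _     = contradiction refl j≢j

  witnessCoord<2⇒end : ∀ i j l → witnessCoord i j l < 2 → l ≡ i ⊎ (l ≡ j × Adj G i j)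
  witnessCoord<2⇒end i j l with l ≟ i | l ≟ j | dec G i j
  ... | yes l≡i | _       | _        = λ _ → inj₁ l≡i
  ... | no  _   | yes l≡j | yes ij∈G = λ _ → inj₂ (l≡j , ij∈G)
  ... | no  _   | yes _   | no  _    = λ { (s≤s (s≤s ())) }
  ... | no  _   | no  _   | _        = λ { (s≤s (s≤s ())) }

  witnessCoord<3 : ∀ i j → Adj G i j → ∀ l → witnessCoord i j l < 3
  witnessCoord<3 i j ij∈G l with l ≟ i | l ≟ j | dec G i j
  ... | yes _ | _     | _       = s≤s z≤n
  ... | no  _ | yes _ | yes _   = s≤s (s≤s z≤n)
  ... | no  _ | yes _ | no ij∉G = contradiction ij∈G ij∉G
  ... | no  _ | no  _ | _       = ≤-refl

  witnessCoord-snd<2 : ∀ i j → Adj G i j → witnessCoord i j j < 2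
  witnessCoord-snd<2 i j ij∈G with j ≟ i | j ≟ j | dec G i j
  ... | yes _ | _      | _       = s≤s z≤n
  ... | no  _ | yes _  | yes _   = ≤-refl
  ... | no  _ | yes _  | no ij∉G = contradiction ij∈G ij∉G
  ... | no  _ | no j≢j | _       = contradiction refl j≢j

  <vertexCoord : ∀ {f : Fin n → ℕ} u → f u < 2 → (∀ l → f l < 3) → ∀ l → f l < vertexCoord u l
  <vertexCoord u fu<2 f<3 l with l ≟ u
  ... | yes refl = fu<2
  ... | no  _    = f<3 l

  witnessCoord-snd-unique : ∀ i j j′ → j ≢ i →
    (∀ l → witnessCoord i j l ≡ witnessCoord i j′ l) → j ≡ j′
  witnessCoord-snd-unique i j j′ j≢i same with j ≟ j′
  ... | yes j≡j′ = j≡j′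
  ... | no  j≢j′ =
    contradiction (trans (same j) (witnessCoord-off i j′ j j≢i j≢j′)) (witnessCoord-snd≢2 i j j≢i)

  witnessCoord-injective : ∀ i j i′ j′ →
    (∀ l → witnessCoord i j l ≡ witnessCoord i′ j′ l) → (i , j) ≡ (i′ , j′)
  witnessCoord-injective i j i′ j′ same
    with refl ← witnessCoord≡0⇒fst i′ j′ i (trans (sym (same i)) (witnessCoord-fst i j))
    with j ≟ i | j′ ≟ i
  ... | no j≢i  | _        = cong (i ,_) (witnessCoord-snd-unique i j j′ j≢i same)
  ... | yes _   | no j′≢i  = cong (i ,_) (sym (witnessCoord-snd-unique i j′ j j′≢i (sym ∘ same)))
  ... | yes j≡i | yes j′≡i = cong (i ,_) (trans j≡i (sym j′≡i))

  coords : PlusIso n (n * n) → Fin n → ℕ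
  coords (inj₁ m) = vertexCoord m
  coords (inj₂ c) = uncurry witnessCoord (remQuot n c)

  embedding : PlusIso n (n * n) → Point n
  embedding = point ∘ coords

  embedding-injective : Injective _≡_ _≡_ embedding
  embedding-injective {inj₁ m} {inj₁ u} eq with u ≟ m
  ... | yes u≡m = cong inj₁ (sym u≡m)
  ... | no  u≢m with () ← trans (sym (vertexCoord-other m u u≢m))
                                 (trans (point-injective eq u) (vertexCoord-self u))
  embedding-injective {inj₁ m} {inj₂ c} eq = let (i , j) = remQuot n c in
    contradiction (trans (point-injective eq i) (witnessCoord-fst i j)) (vertexCoord≢0 m i)
  embedding-injective {inj₂ c} {inj₁ m} eq = let (i , j) = remQuot n c in
    contradiction (trans (sym (point-injective eq i)) (witnessCoord-fst i j)) (vertexCoord≢0 m i)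
  embedding-injective {inj₂ c} {inj₂ c′} eq =
    cong inj₂ (remQuot-injective n (witnessCoord-injective _ _ _ _ (point-injective eq)))

  nothing-below-witness : ∀ w c → ¬ embedding w ≺ embedding (inj₂ c)
  nothing-below-witness w c = let (i , j) = remQuot n c in point-≺-zero i (witnessCoord-fst i j)

  vertices-incomparable : ∀ m u → ¬ embedding (inj₁ m) ≺ embedding (inj₁ u)
  vertices-incomparable m u x≺x =
    ≤⇒≯ (2≤vertexCoord m u) (subst (vertexCoord m u <_) (vertexCoord-self u) (point-≺⁻ x≺x u))

  witness-below-vertex : ∀ i j u →
    point (witnessCoord i j) ≺ embedding (inj₁ u) → u ≡ i ⊎ (u ≡ j × Adj G i j)
  witness-below-vertex i j u z≺x =
    witnessCoord<2⇒end i j u (subst (witnessCoord i j u <_) (vertexCoord-self u) (point-≺⁻ z≺x u))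

  embedding-combine : ∀ i j → embedding (inj₂ (combine i j)) ≡ point (witnessCoord i j)
  embedding-combine i j = cong (point ∘ uncurry witnessCoord) (remQuot-combine i j)

  witness-below-ends : ∀ i j → Adj G i j →
    embedding (inj₂ (combine i j)) ≺ embedding (inj₁ i) ×
    embedding (inj₂ (combine i j)) ≺ embedding (inj₁ j)
  witness-below-ends i j ij∈G = below (<vertexCoord i wᵢ<2 w<3) , below (<vertexCoord j wⱼ<2 w<3)
    where
    below : ∀ {u} → (∀ l → witnessCoord i j l < vertexCoord u l) →
            embedding (inj₂ (combine i j)) ≺ embedding (inj₁ u)
    below w<x = subst (_≺ _) (sym (embedding-combine i j)) (point-≺⁺ w<x)
    wᵢ<2 : witnessCoord i j i < 2
    wᵢ<2 = subst (_< 2) (sym (witnessCoord-fst i j)) (s≤s z≤n)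
    wⱼ<2 : witnessCoord i j j < 2
    wⱼ<2 = witnessCoord-snd<2 i j ij∈G
    w<3 : ∀ l → witnessCoord i j l < 3
    w<3 = witnessCoord<3 i j ij∈G

  commonPrey⇒Adj : ∀ i j → i ≢ j → CompAdj embedding (inj₁ i) (inj₁ j) → Adj G i j
  commonPrey⇒Adj i j i≢j (inj₁ m , x≺xᵢ , _) = contradiction x≺xᵢ (vertices-incomparable m i)
  commonPrey⇒Adj i j i≢j (inj₂ c , z≺xᵢ , z≺xⱼ)
    with witness-below-vertex _ _ i z≺xᵢ | witness-below-vertex _ _ j z≺xⱼ
  ... | inj₁ refl          | inj₁ refl          = contradiction refl i≢j
  ... | inj₁ refl          | inj₂ (refl , ij∈G) = ij∈G
  ... | inj₂ (refl , ji∈G) | inj₁ refl          = SimpleGraph.sym G ji∈G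
  ... | inj₂ (refl , _)    | inj₂ (refl , _)    = contradiction refl i≢j

  embedding-represents : ∀ u v → u ≢ v → AdjPlus G (n * n) u v ⇔ CompAdj embedding u v
  embedding-represents (inj₁ i) (inj₁ j) u≢v =
    mk⇔ (λ ij∈G → inj₂ (combine i j) , witness-below-ends i j ij∈G)
        (commonPrey⇒Adj i j (u≢v ∘ cong inj₁))
  embedding-represents (inj₁ i) (inj₂ c) _ = mk⇔ (λ ()) (λ (w , _ , w≺z) → nothing-below-witness w c w≺z)
  embedding-represents (inj₂ c) v _ = mk⇔ (λ ()) (λ (w , w≺z , _) → nothing-below-witness w c w≺z)

proposition3p5 : (n : ℕ) (G : SimpleGraph n) → DimPocLe G n
proposition3p5 n G = n , ≤-refl , n * n , embedding , embedding-injective , embedding-represents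
  where open Construction G
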